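{- Up to renaming of the colors, there are exactly two rainbow-free colorings of $[3]^3$ using exactly 10 colors.
   Context: $[3]^3$ is the set of words $x=(x_1,x_2,x_3)$ with $x_i\in\{1,2,3\}$. A combinatorial line is determined by a word $w\in(\{1,2,3\}\cup\{*\})^3$ containing at least one $*$; it consists of the 3 points $w(1),w(2),w(3)$, where $w(i)$ is obtained from $w$ by replacing every $*$ by $i$. A line is rainbow if its 3 points receive 3 pairwise different colors; a coloring is rainbow-free if no combinatorial line is rainbow. -}

module Defs where

open import Data.Nat renaming (ℕ to Nat) using ()
open import Data.Fin using (Fin; zero; suc)
open import Data.Vec using (Vec; map)
open import Data.Vec.Membership.Propositional using (_∈_)
open import Data.Maybe using (Maybe; nothing; just; fromMaybe)
open import Data.Product using (Σ; ∃; _×_; _,_)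
open import Data.Sum using (_⊎_)
open import Relation.Binary.PropositionalEquality using (_≡_; _≢_)
open import Relation.Nullary using (¬_)
open import Function.Bundles using (_↔_; Inverse)

-- [3] = Fin 3 (the symbols 1,2,3 are zero, suc zero, suc (suc zero))
-- a point of [3]^3 is a word of length 3 over [3]
Point : Set
Point = Vec (Fin 3) 3

-- a word over [3] ∪ {*}, where * is represented by nothing
Word : Set
Word = Vec (Maybe (Fin 3)) 3

IsLine : Word → Set
IsLine w = nothing ∈ w

apply : Word → Fin 3 → Point
apply w i = map (fromMaybe i) w

one two three : Fin 3
one = zero
two = suc zero
three = suc (suc zero)

Coloring : Set → Set
Coloring C = Point → C

Rainbow : {C : Set} → Coloring C → Word → Set
Rainbow c w =
  (c (apply w one) ≢ c (apply w two)) ×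
  (c (apply w one) ≢ c (apply w three)) ×
  (c (apply w two) ≢ c (apply w three))

RainbowFree : {C : Set} → Coloring C → Set
RainbowFree c = (w : Word) → IsLine w → ¬ Rainbow c w

-- a coloring using exactly n colors, normalised to use the color set Fin n
-- with every color actually used
UsesAll : {n : Nat} → Coloring (Fin n) → Set
UsesAll c = ∀ k → ∃ λ x → c x ≡ k

SameUpToRenaming : {n : Nat} → Coloring (Fin n) → Coloring (Fin n) → Set
SameUpToRenaming {n} c c' =
  Σ (Fin n ↔ Fin n) λ σ → ∀ x → c' x ≡ Inverse.to σ (c x)

Good : (n : Nat) → Coloring (Fin n) → Set
Good n c = RainbowFree c × UsesAll c

-- A plane {a} × [3]² of a rainbow-free colouring carries at most four colours: with five, two
-- rows would hold two of them each and a third row one more, and the column through that last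
-- point would be rainbow. Give every colour the level a of one point carrying it. As 10 colours
-- are spread over three levels of at most four, the level sizes are 4,4,2 or 4,3,3; two full
-- levels are impossible, since the vertical line through a point of the third level would be
-- rainbow. Comparing the planes of a 4,3,3 split shows that a single colour g fills every
-- vertical line up to at most one point. Since all 10 colours occur, each vertical line has
-- exactly one such point, the nine of them carry nine different colours, and they form the graph
-- of a map [3]² → [3] meeting no combinatorial line twice; a finite check shows that this graph
-- is one of the two sets x₁ + x₂ + x₃ ≡ 1 and x₁ + x₂ + x₃ ≡ 2 (mod 3).
module Submission where

open import Defs
open import Data.Empty using (⊥; ⊥-elim)
open import Data.Fin using (Fin; zero; suc; _≟_; punchIn; punchOut; inject≤; combine; remQuot)
open import Data.Fin.Patterns using (0F; 1F; 2F)
open import Data.Fin.Properties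
  using (suc-injective; punchInᵢ≢i; punchOut-injective; inject≤-injective; injective⇒≤;
         remQuot-combine; combine-remQuot; any?; all?)
open import Data.Maybe using (Maybe; just; nothing)
open import Data.Maybe.Properties using () renaming (≡-dec to ≡-dec-Maybe)
open import Data.Nat using (ℕ; zero; suc; _+_; _≤_; _≤?_; s≤s)
open import Data.Nat.Properties using (+-suc; 1+n≰n; ≰⇒>; n≤1+n; allUpTo?) renaming (_≟_ to _≟ℕ_)
open import Data.Product using (Σ; Σ-syntax; ∃; _×_; _,_; proj₁; proj₂; uncurry)
open import Data.Sum using (_⊎_; inj₁; inj₂; [_,_]′)
import Data.Sum as Sum
import Data.Vec as Vec
open import Data.Vec.Functional using (_∷_; [])
open import Data.Vec.Membership.DecPropositional (≡-dec-Maybe (_≟_ {3})) using (_∈?_)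
open import Data.Vec.Relation.Unary.Any using (here; there)
open import Function using (_∘_)
open import Function.Bundles using (_↔_; mk↔ₛ′)
open import Function.Definitions using (Injective; StrictlySurjective)
open import Relation.Binary.Definitions using (DecidableEquality)
open import Relation.Binary.PropositionalEquality
  using (_≡_; _≢_; refl; sym; trans; cong; ≢-sym; module ≡-Reasoning)
open import Relation.Nullary using (¬_; Dec; yes; no; ¬?; contradiction)
open import Relation.Nullary.Decidable using (_×-dec_; _⊎-dec_; _→-dec_; map′; from-yes)

pattern ⟨_,_,_⟩ a b d = a Vec.∷ b Vec.∷ d Vec.∷ Vec.[]
pattern ⋆ = nothing

Distinct₃ : {A : Set} → A → A → A → Set
Distinct₃ x y z = x ≢ y × x ≢ z × y ≢ z

∷-injective : ∀ {A : Set} {n} {x : A} {e : Fin n → A} →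
              (∀ i → e i ≢ x) → Injective _≡_ _≡_ e → Injective _≡_ _≡_ (x ∷ e)
∷-injective fresh inj {zero}  {zero}  _  = refl
∷-injective fresh inj {zero}  {suc j} eq = ⊥-elim (fresh j (sym eq))
∷-injective fresh inj {suc i} {zero}  eq = ⊥-elim (fresh i eq)
∷-injective fresh inj {suc i} {suc j} eq = cong suc (inj eq)

injective₃ : ∀ {A : Set} {x y z : A} → Distinct₃ x y z → Injective _≡_ _≡_ (x ∷ y ∷ z ∷ [])
injective₃ (x≢y , x≢z , y≢z) =
  ∷-injective {n = 2} (λ { 0F → ≢-sym x≢y ; 1F → ≢-sym x≢z })
    (∷-injective {n = 1} (λ { 0F → ≢-sym y≢z }) (∷-injective (λ ()) λ { {()} }))

injective⇒distinct : ∀ {A : Set} {v : Fin 3 → A} → Injective _≡_ _≡_ v → Distinct₃ (v 0F) (v 1F) (v 2F)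
injective⇒distinct inj = (λ ()) ∘ inj , (λ ()) ∘ inj , (λ ()) ∘ inj

injective⇒surjective : ∀ {n} {e : Fin n → Fin n} → Injective _≡_ _≡_ e → StrictlySurjective _≡_ e
injective⇒surjective {suc n} {e} inj k with any? (λ i → e i ≟ k)
... | yes hit = hit
... | no miss = contradiction (injective⇒≤ squeezed-injective) 1+n≰n
  where
  squeezed : Fin (suc n) → Fin n
  squeezed i = punchOut {i = k} {j = e i} λ k≡ei → miss (i , sym k≡ei)
  squeezed-injective : Injective _≡_ _≡_ squeezed
  squeezed-injective eq = inj (punchOut-injective {i = k} _ _ eq)

surjective⇒injective : ∀ {n} {e : Fin n → Fin n} → StrictlySurjective _≡_ e → Injective _≡_ _≡_ e
surjective⇒injective {suc n} {e} surj {i} {j} ei≡ej with i ≟ j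
... | yes i≡j = i≡j
... | no i≢j = contradiction (injective⇒≤ section-injective) 1+n≰n
  where
  -- Every point has a preimage other than j, because e j also has the preimage i.
  preimage : ∀ k → Σ[ x ∈ Fin (suc n) ] x ≢ j × e x ≡ k
  preimage k with surj k
  ... | x , ex≡k with x ≟ j
  ... | yes refl = i , i≢j , trans ei≡ej ex≡k
  ... | no x≢j = x , x≢j , ex≡k
  section : Fin (suc n) → Fin n
  section k = punchOut (≢-sym (proj₁ (proj₂ (preimage k))))
  section-injective : Injective _≡_ _≡_ section
  section-injective {k} {k′} eq = begin
    k                       ≡⟨ sym (proj₂ (proj₂ (preimage k))) ⟩
    e (proj₁ (preimage k))  ≡⟨ cong e (punchOut-injective {i = j} _ _ eq) ⟩
    e (proj₁ (preimage k′)) ≡⟨ proj₂ (proj₂ (preimage k′)) ⟩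
    k′                      ∎
    where open ≡-Reasoning

permutation : ∀ {n} (e : Fin n → Fin n) → StrictlySurjective _≡_ e → Fin n ↔ Fin n
permutation e surj = mk↔ₛ′ e (proj₁ ∘ surj) (proj₂ ∘ surj)
  (λ x → surjective⇒injective surj (proj₂ (surj (e x))))

injective-≗ : ∀ {A B : Set} {g h : A → B} → (∀ x → g x ≡ h x) →
              Injective _≡_ _≡_ h → Injective _≡_ _≡_ g
injective-≗ g≗h inj eq = inj (trans (sym (g≗h _)) (trans eq (g≗h _)))

injective-reindex : ∀ {A : Set} {n} {v : Fin n → A} (e : Fin n → Fin n) →
                    Injective _≡_ _≡_ (v ∘ e) → Injective _≡_ _≡_ v
injective-reindex {v = v} e inj {x} {y} vx≡vy
  with injective⇒surjective (inj ∘ cong v) x | injective⇒surjective (inj ∘ cong v) y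
... | x′ , refl | y′ , refl = cong e (inj vx≡vy)

distinct⇒injective : ∀ {A : Set} {v : Fin 3 → A} {x y z} → Distinct₃ (v x) (v y) (v z) → Injective _≡_ _≡_ v
distinct⇒injective {x = x} {y} {z} distinct = injective-reindex (x ∷ y ∷ z ∷ [])
  (injective-≗ (λ { 0F → refl ; 1F → refl ; 2F → refl }) (injective₃ distinct))

cover₃ : ∀ {x y z : Fin 3} → Distinct₃ x y z → ∀ i → i ≡ x ⊎ i ≡ y ⊎ i ≡ z
cover₃ distinct i with injective⇒surjective (injective₃ distinct) i
... | 0F , refl = inj₁ refl
... | 1F , refl = inj₂ (inj₁ refl)
... | 2F , refl = inj₂ (inj₂ refl)

allBut : ∀ {P : Fin 3 → Set} {x y z} → Distinct₃ x y z → P x → P y → ∀ i → i ≢ z → P i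
allBut distinct px py i i≢z with cover₃ distinct i
... | inj₁ refl = px
... | inj₂ (inj₁ refl) = py
... | inj₂ (inj₂ i≡z) = ⊥-elim (i≢z i≡z)

another : (i j : Fin 3) → ∃ λ k → k ≢ i × k ≢ j
another 0F 0F = 1F , (λ ()) , (λ ())
another 0F 1F = 2F , (λ ()) , (λ ())
another 0F 2F = 1F , (λ ()) , (λ ())
another 1F 0F = 2F , (λ ()) , (λ ())
another 1F 1F = 0F , (λ ()) , (λ ())
another 1F 2F = 0F , (λ ()) , (λ ())
another 2F 0F = 1F , (λ ()) , (λ ())
another 2F 1F = 0F , (λ ()) , (λ ())
another 2F 2F = 0F , (λ ()) , (λ ())

noInjectionIntoPair : ∀ {A : Set} {v : Fin 3 → A} {a b} →
                      Injective _≡_ _≡_ v → (∀ i → v i ≡ a ⊎ v i ≡ b) → ⊥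
noInjectionIntoPair inj into with into 0F | into 1F | into 2F
... | inj₁ p | inj₁ q | _      = contradiction (inj (trans p (sym q))) λ ()
... | inj₂ p | inj₂ q | _      = contradiction (inj (trans p (sym q))) λ ()
... | inj₁ p | _      | inj₁ r = contradiction (inj (trans p (sym r))) λ ()
... | inj₂ p | _      | inj₂ r = contradiction (inj (trans p (sym r))) λ ()
... | _      | inj₁ q | inj₁ r = contradiction (inj (trans q (sym r))) λ ()
... | _      | inj₂ q | inj₂ r = contradiction (inj (trans q (sym r))) λ ()

module NotInjective {A : Set} (_≟ᴬ_ : DecidableEquality A) {v : Fin 3 → A} (¬inj : ¬ Injective _≡_ _≡_ v) where

  agrees-with-one : ∀ {x y} → v x ≢ v y → ∀ z → v z ≡ v x ⊎ v z ≡ v y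
  agrees-with-one x≢y z with v z ≟ᴬ _ | v z ≟ᴬ _
  ... | yes p | _     = inj₁ p
  ... | no _  | yes q = inj₂ q
  ... | no p  | no q  = ⊥-elim (¬inj (distinct⇒injective (x≢y , ≢-sym p , ≢-sym q)))

  some-pair-agrees : ∀ x y z → v x ≡ v y ⊎ v x ≡ v z ⊎ v y ≡ v z
  some-pair-agrees x y z with v x ≟ᴬ v y
  ... | yes p = inj₁ p
  ... | no x≢y with agrees-with-one x≢y z
  ... | inj₁ p = inj₂ (inj₁ (sym p))
  ... | inj₂ q = inj₂ (inj₂ (sym q))

record Fibre≥ {A B : Set} (s : A → B) (b : B) (m : ℕ) : Set where
  field
    element   : Fin m → A
    injective : Injective _≡_ _≡_ element
    lies-over : ∀ i → s (element i) ≡ b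
open Fibre≥

restrict : ∀ {A B : Set} {s : A → B} {b m m′} → m′ ≤ m → Fibre≥ s b m → Fibre≥ s b m′
restrict m′≤m F = record
  { element   = λ i → element F (inject≤ i m′≤m)
  ; injective = λ eq → inject≤-injective m′≤m m′≤m _ _ (injective F eq)
  ; lies-over = λ i → lies-over F (inject≤ i m′≤m)
  }

bump : Fin 3 → (Fin 3 → ℕ) → Fin 3 → ℕ
bump b₀ m b with b ≟ b₀
... | yes _ = suc (m b)
... | no _  = m b

bump-total : ∀ b₀ m → bump b₀ m 0F + bump b₀ m 1F + bump b₀ m 2F ≡ suc (m 0F + m 1F + m 2F)
bump-total 0F m = refl
bump-total 1F m = cong (_+ m 2F) (+-suc (m 0F) (m 1F))
bump-total 2F m = +-suc (m 0F + m 1F) (m 2F)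

fibre-suc : ∀ {n} {m : Fin 3 → ℕ} {b} {s : Fin (suc n) → Fin 3} →
            Fibre≥ (s ∘ suc) b (m b) → Fibre≥ s b (bump (s zero) m b)
fibre-suc {b = b} {s} F with b ≟ s zero
... | yes refl = record
  { element   = zero ∷ suc ∘ element F
  ; injective = ∷-injective (λ i ()) (injective F ∘ suc-injective)
  ; lies-over = λ { zero → refl ; (suc i) → lies-over F i }
  }
... | no _ = record
  { element   = suc ∘ element F
  ; injective = injective F ∘ suc-injective
  ; lies-over = lies-over F
  }

fibreSizes : ∀ {n} (s : Fin n → Fin 3) →
             Σ[ m ∈ (Fin 3 → ℕ) ] m 0F + m 1F + m 2F ≡ n × (∀ b → Fibre≥ s b (m b))
fibreSizes {zero} s = (λ _ → 0) , refl , λ b → record { element = λ () ; injective = λ { {()} } ; lies-over = λ () }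
fibreSizes {suc n} s with fibreSizes (s ∘ suc)
... | m , total , F = bump (s zero) m , trans (bump-total (s zero) m) (cong suc total) , λ b → fibre-suc (F b)

partition-of-5 : ∀ {x y z} → x ≤ 2 → y ≤ 2 → z ≤ 2 → x + y + z ≡ 5 →
  (2 ≤ x × 2 ≤ y × 1 ≤ z) ⊎ (2 ≤ x × 1 ≤ y × 2 ≤ z) ⊎ (1 ≤ x × 2 ≤ y × 2 ≤ z)
partition-of-5 x≤2 y≤2 z≤2 = from-yes
  (allUpTo? (λ x → allUpTo? (λ y → allUpTo? (λ z → x + y + z ≟ℕ 5 →-dec
    ((2 ≤? x ×-dec 2 ≤? y ×-dec 1 ≤? z) ⊎-dec (2 ≤? x ×-dec 1 ≤? y ×-dec 2 ≤? z) ⊎-dec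
     (1 ≤? x ×-dec 2 ≤? y ×-dec 2 ≤? z))) 3) 3) 3)
  (s≤s x≤2) (s≤s y≤2) (s≤s z≤2)

partition-of-10 : ∀ {x y z} → x ≤ 4 → y ≤ 4 → z ≤ 4 → x + y + z ≡ 10 →
  (4 ≤ x × 4 ≤ y × 1 ≤ z) ⊎ (4 ≤ x × 4 ≤ z × 1 ≤ y) ⊎ (4 ≤ y × 4 ≤ z × 1 ≤ x) ⊎
  (4 ≤ x × 3 ≤ y × 3 ≤ z) ⊎ (4 ≤ y × 3 ≤ x × 3 ≤ z) ⊎ (4 ≤ z × 3 ≤ x × 3 ≤ y)
partition-of-10 x≤4 y≤4 z≤4 = from-yes
  (allUpTo? (λ x → allUpTo? (λ y → allUpTo? (λ z → x + y + z ≟ℕ 10 →-dec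
    ((4 ≤? x ×-dec 4 ≤? y ×-dec 1 ≤? z) ⊎-dec (4 ≤? x ×-dec 4 ≤? z ×-dec 1 ≤? y) ⊎-dec
     (4 ≤? y ×-dec 4 ≤? z ×-dec 1 ≤? x) ⊎-dec (4 ≤? x ×-dec 3 ≤? y ×-dec 3 ≤? z) ⊎-dec
     (4 ≤? y ×-dec 3 ≤? x ×-dec 3 ≤? z) ⊎-dec (4 ≤? z ×-dec 3 ≤? x ×-dec 3 ≤? y))) 5) 5) 5)
  (s≤s x≤4) (s≤s y≤4) (s≤s z≤4)

-- A 3 × 3 grid without rainbow rows or columns

Cell : Set
Cell = Fin 3 × Fin 3

module RowColumnGrid {C : Set} (_≟ᶜ_ : DecidableEquality C) (γ : Cell → C)
         (rows : ∀ b → ¬ Injective _≡_ _≡_ (λ d → γ (b , d)))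
         (columns : ∀ d → ¬ Injective _≡_ _≡_ (λ b → γ (b , d)))
         (κ : Fin 5 → C) (κ-injective : Injective _≡_ _≡_ κ)
         (occurs : ∀ i → ∃ λ p → γ p ≡ κ i) where

  row column : Fin 5 → Fin 3
  row i = proj₁ (proj₁ (occurs i))
  column i = proj₂ (proj₁ (occurs i))

  at : ∀ {a i} → row i ≡ a → γ (a , column i) ≡ κ i
  at refl = proj₂ (occurs _)

  apart : ∀ {x y p q} → x ≡ κ p → y ≡ κ q → p ≢ q → x ≢ y
  apart refl refl p≢q = p≢q ∘ κ-injective

  rowsApart : ∀ {p q a a′} → row p ≡ a → row q ≡ a′ → a ≢ a′ → p ≢ q
  rowsApart refl refl a≢a′ = a≢a′ ∘ cong row

  rowHoldsTwo : ∀ {a} → Fibre≥ row a 3 → ⊥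
  rowHoldsTwo {a} F = rows a (injective-reindex (column ∘ element F)
    (injective-≗ (at ∘ lies-over F) (injective F ∘ κ-injective)))

  rowSize≤2 : ∀ {a m} → Fibre≥ row a m → m ≤ 2
  rowSize≤2 {m = m} F with m ≤? 2
  ... | yes m≤2 = m≤2
  ... | no m≰2 = ⊥-elim (rowHoldsTwo (restrict (≰⇒> m≰2) F))

  rowValue : ∀ {a} → Fibre≥ row a 2 → ∀ d → ∃ λ p → row p ≡ a × γ (a , d) ≡ κ p
  rowValue {a} F d = [ value 0F , value 1F ]′ (NotInjective.agrees-with-one _≟ᶜ_ (rows a) κ₀≢κ₁ d)
    where
    value : ∀ i → γ (a , d) ≡ γ (a , column (element F i)) → ∃ λ p → row p ≡ a × γ (a , d) ≡ κ p
    value i eq = element F i , lies-over F i , trans eq (at (lies-over F i))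
    κ₀≢κ₁ : γ (a , column (element F 0F)) ≢ γ (a , column (element F 1F))
    κ₀≢κ₁ = apart (at (lies-over F 0F)) (at (lies-over F 1F)) ((λ ()) ∘ injective F)

  noSplit : ∀ {A B C} → Distinct₃ A B C → Fibre≥ row A 2 → Fibre≥ row B 2 → Fibre≥ row C 1 → ⊥
  noSplit (A≢B , A≢C , B≢C) FA FB FC =
    let p , rp , vp = rowValue FA d
        q , rq , vq = rowValue FB d
    in columns d (distinct⇒injective
         (apart vp vq (rowsApart rp rq A≢B) , apart vp vk (rowsApart rp rk A≢C) , apart vq vk (rowsApart rq rk B≢C)))
    where
    rk = lies-over FC 0F
    d = column (element FC 0F)
    vk = at rk

  atMostFourColours : ⊥
  atMostFourColours with fibreSizes row
  ... | m , total , F with partition-of-5 (rowSize≤2 (F 0F)) (rowSize≤2 (F 1F)) (rowSize≤2 (F 2F)) total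
  ... | inj₁ (p , q , r) =
    noSplit ((λ ()) , (λ ()) , (λ ())) (restrict p (F 0F)) (restrict q (F 1F)) (restrict r (F 2F))
  ... | inj₂ (inj₁ (p , q , r)) =
    noSplit ((λ ()) , (λ ()) , (λ ())) (restrict p (F 0F)) (restrict r (F 2F)) (restrict q (F 1F))
  ... | inj₂ (inj₂ (p , q , r)) =
    noSplit ((λ ()) , (λ ()) , (λ ())) (restrict q (F 1F)) (restrict r (F 2F)) (restrict p (F 0F))

-- Sections of [3]³ → [3]² and their graphs

pointAt : Fin 3 → Cell → Point
pointAt a p = ⟨ a , proj₁ p , proj₂ p ⟩

levelOf : Point → Fin 3
levelOf ⟨ a , _ , _ ⟩ = a

cellOf : Point → Cell
cellOf ⟨ _ , b , d ⟩ = b , d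

Section : Set
Section = Cell → Fin 3

OnGraph : Section → Point → Set
OnGraph f x = levelOf x ≡ f (cellOf x)

onGraph? : ∀ f x → Dec (OnGraph f x)
onGraph? f x = levelOf x ≟ f (cellOf x)

LineFree : Section → Set
LineFree f = ∀ w → IsLine w → ∀ i j → i ≢ j → OnGraph f (apply w i) → ¬ OnGraph f (apply w j)

all-Maybe? : ∀ {n} {P : Maybe (Fin n) → Set} → (∀ m → Dec (P m)) → Dec (∀ m → P m)
all-Maybe? P? = map′ (λ { (p , q) → λ { ⋆ → p ; (just a) → q a } }) (λ h → h ⋆ , h ∘ just)
  (P? ⋆ ×-dec all? (P? ∘ just))

lineFree? : ∀ f → Dec (LineFree f)
lineFree? f = map′ (λ h → λ { ⟨ x , y , z ⟩ → h x y z }) (λ h x y z → h ⟨ x , y , z ⟩)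
  (all-Maybe? λ x → all-Maybe? λ y → all-Maybe? λ z → noTwoOn? ⟨ x , y , z ⟩)
  where
  noTwoOn? : ∀ w → Dec (IsLine w → ∀ i j → i ≢ j → OnGraph f (apply w i) → ¬ OnGraph f (apply w j))
  noTwoOn? w = ⋆ ∈? w →-dec all? λ i → all? λ j →
    ¬? (i ≟ j) →-dec (onGraph? f (apply w i) →-dec ¬? (onGraph? f (apply w j)))

_≐_ : Section → Section → Set
f ≐ f′ = ∀ b d → f (b , d) ≡ f′ (b , d)

_≐?_ : ∀ f f′ → Dec (f ≐ f′)
f ≐? f′ = all? λ b → all? λ d → f (b , d) ≟ f′ (b , d)

table : (x₀₀ x₀₁ x₀₂ x₁₀ x₁₁ x₁₂ x₂₀ x₂₁ x₂₂ : Fin 3) → Section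
table x₀₀ x₀₁ x₀₂ x₁₀ x₁₁ x₁₂ x₂₀ x₂₁ x₂₂ = λ where
  (0F , 0F) → x₀₀ ; (0F , 1F) → x₀₁ ; (0F , 2F) → x₀₂
  (1F , 0F) → x₁₀ ; (1F , 1F) → x₁₁ ; (1F , 2F) → x₁₂
  (2F , 0F) → x₂₀ ; (2F , 1F) → x₂₁ ; (2F , 2F) → x₂₂

tabulate : Section → Section
tabulate f = table (f (0F , 0F)) (f (0F , 1F)) (f (0F , 2F)) (f (1F , 0F)) (f (1F , 1F)) (f (1F , 2F))
                   (f (2F , 0F)) (f (2F , 1F)) (f (2F , 2F))

tabulate-≐ : ∀ f → tabulate f ≐ f
tabulate-≐ f 0F 0F = refl
tabulate-≐ f 0F 1F = refl
tabulate-≐ f 0F 2F = refl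
tabulate-≐ f 1F 0F = refl
tabulate-≐ f 1F 1F = refl
tabulate-≐ f 1F 2F = refl
tabulate-≐ f 2F 0F = refl
tabulate-≐ f 2F 1F = refl
tabulate-≐ f 2F 2F = refl

-- F₁ and F₂ select the points whose coordinates sum to 1, resp. 2, modulo 3.
F₁ F₂ : Section
F₁ = table 1F 0F 2F 0F 2F 1F 2F 1F 0F
F₂ = table 2F 1F 0F 1F 0F 2F 0F 2F 1F

lineFree-≐ : ∀ {f f′} → f ≐ f′ → LineFree f′ → LineFree f
lineFree-≐ {f} {f′} f≐f′ lf w line i j i≢j on-i on-j = lf w line i j i≢j (move on-i) (move on-j)
  where
  move : ∀ {x} → OnGraph f x → OnGraph f′ x
  move {x} on = trans on (f≐f′ (proj₁ (cellOf x)) (proj₂ (cellOf x)))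

rowInjective : ∀ {f} → LineFree f → ∀ b → Injective _≡_ _≡_ (λ d → f (b , d))
rowInjective {f} lf b {d} {d′} eq with d ≟ d′
... | yes d≡d′ = d≡d′
... | no d≢d′ = ⊥-elim (lf ⟨ just (f (b , d)) , just b , ⋆ ⟩ (there (there (here refl))) d d′ d≢d′ refl eq)

-- Decided by evaluation; requiring distinct rows first cuts the 3⁹ tables down to 6³.
lineFree-tables : ∀ a b c → Distinct₃ a b c → ∀ d e f → Distinct₃ d e f → ∀ g h i → Distinct₃ g h i →
                  let T = table a b c d e f g h i in LineFree T → T ≐ F₁ ⊎ T ≐ F₂
lineFree-tables = from-yes
  (all? λ a → all? λ b → all? λ c → distinct? a b c →-dec
   all? λ d → all? λ e → all? λ f → distinct? d e f →-dec
   all? λ g → all? λ h → all? λ i → distinct? g h i →-dec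
   (let T = table a b c d e f g h i in lineFree? T →-dec (T ≐? F₁ ⊎-dec T ≐? F₂)))
  where
  distinct? : ∀ x y z → Dec (Distinct₃ x y z)
  distinct? x y z = ¬? (x ≟ y) ×-dec ¬? (x ≟ z) ×-dec ¬? (y ≟ z)

lineFree-classification : ∀ f → LineFree f → f ≐ F₁ ⊎ f ≐ F₂
lineFree-classification f lf = Sum.map via-table via-table
  (lineFree-tables _ _ _ (row 0F) _ _ _ (row 1F) _ _ _ (row 2F) (lineFree-≐ (tabulate-≐ f) lf))
  where
  row : ∀ b → Distinct₃ (f (b , 0F)) (f (b , 1F)) (f (b , 2F))
  row b = injective⇒distinct {v = λ d → f (b , d)} (rowInjective lf b)
  via-table : ∀ {F} → tabulate f ≐ F → f ≐ F
  via-table T≐F b d = trans (sym (tabulate-≐ f b d)) (T≐F b d)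

canonical : Section → Coloring (Fin 10)
canonical f x with onGraph? f x
... | yes _ = suc (uncurry combine (cellOf x))
... | no _  = 0F

canonical-on : ∀ {f x} → OnGraph f x → canonical f x ≡ suc (uncurry combine (cellOf x))
canonical-on {f} {x} on with onGraph? f x
... | yes _ = refl
... | no off = ⊥-elim (off on)

canonical-off : ∀ {f x} → ¬ OnGraph f x → canonical f x ≡ 0F
canonical-off {f} {x} off with onGraph? f x
... | yes on = ⊥-elim (off on)
... | no _ = refl

canonical-≐ : ∀ {f f′} → f ≐ f′ → ∀ x → canonical f x ≡ canonical f′ x
canonical-≐ {f} {f′} f≐f′ x with onGraph? f x | onGraph? f′ x
... | yes _  | yes _  = refl
... | no _   | no _   = refl
... | yes on | no off = ⊥-elim (off (trans on (f≐f′ _ _)))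
... | no off | yes on = ⊥-elim (off (trans on (sym (f≐f′ _ _))))

canonical-usesAll : ∀ f → UsesAll (canonical f)
canonical-usesAll f 0F = pointAt (punchIn (f (0F , 0F)) 0F) (0F , 0F) , canonical-off (punchInᵢ≢i _ _)
canonical-usesAll f (suc j) =
  pointAt (f (remQuot 3 j)) (remQuot 3 j) , trans (canonical-on refl) (cong suc (combine-remQuot {3} 3 j))

canonical-rainbowFree : ∀ {f} → LineFree f → RainbowFree (canonical f)
canonical-rainbowFree {f} lf w line (c₁≢c₂ , c₁≢c₃ , c₂≢c₃)
  with onGraph? f (apply w one) | onGraph? f (apply w two) | onGraph? f (apply w three)
... | yes on₁ | yes on₂ | _       = lf w line one two (λ ()) on₁ on₂
... | yes on₁ | _       | yes on₃ = lf w line one three (λ ()) on₁ on₃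
... | _       | yes on₂ | yes on₃ = lf w line two three (λ ()) on₂ on₃
... | no _    | no _    | _       = c₁≢c₂ refl
... | no _    | _       | no _    = c₁≢c₃ refl
... | _       | no _    | no _    = c₂≢c₃ refl

-- ⟨1,1,1⟩ and ⟨3,1,1⟩ share a colour in the first colouring but not in the second.
canonical-F₁≉F₂ : ¬ SameUpToRenaming (canonical F₁) (canonical F₂)
canonical-F₁≉F₂ (σ , renamed) with trans (renamed ⟨ 0F , 0F , 0F ⟩) (sym (renamed ⟨ 2F , 0F , 0F ⟩))
... | ()

-- Rainbow-free colourings with ten colours

module Classification (c : Coloring (Fin 10)) (rainbowFree : RainbowFree c) (usesAll : UsesAll c) where

  colourAt : Fin 3 → Cell → Fin 10
  colourAt a p = c (pointAt a p)

  lineNotInjective : ∀ {w} → IsLine w → ¬ Injective _≡_ _≡_ (c ∘ apply w)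
  lineNotInjective {w} line inj = rainbowFree w line ((λ ()) ∘ inj , (λ ()) ∘ inj , (λ ()) ∘ inj)

  verticalNotInjective : ∀ p → ¬ Injective _≡_ _≡_ (λ a → colourAt a p)
  verticalNotInjective (b , d) = lineNotInjective {⟨ ⋆ , just b , just d ⟩} (here refl)

  Occurs : Fin 3 → Fin 10 → Set
  Occurs a k = ∃ λ p → colourAt a p ≡ k

  atMostFourColours : ∀ a (κ : Fin 5 → Fin 10) → Injective _≡_ _≡_ κ → (∀ i → Occurs a (κ i)) → ⊥
  atMostFourColours a = RowColumnGrid.atMostFourColours _≟_ (colourAt a)
    (λ b → lineNotInjective {⟨ just a , just b , ⋆ ⟩} (there (there (here refl))))
    (λ d → lineNotInjective {⟨ just a , ⋆ , just d ⟩} (there (here refl)))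

  occurrence : ∀ k → ∃ λ a → Occurs a k
  occurrence k with usesAll k
  ... | ⟨ a , b , d ⟩ , e = a , (b , d) , e

  level : Fin 10 → Fin 3
  level = proj₁ ∘ occurrence

  site : ∀ {k a} → level k ≡ a → Cell
  site {k} refl = proj₁ (proj₂ (occurrence k))

  colourAtSite : ∀ {k a} (e : level k ≡ a) → colourAt a (site e) ≡ k
  colourAtSite {k} refl = proj₂ (proj₂ (occurrence k))

  occursAtLevel : ∀ {k a} → level k ≡ a → Occurs a k
  occursAtLevel e = site e , colourAtSite e

  levelAtSite : ∀ {k a} (e : level k ≡ a) → level (colourAt a (site e)) ≡ a
  levelAtSite e = trans (cong level (colourAtSite e)) e

  levelsApart : ∀ {x y a a′} → level x ≡ a → level y ≡ a′ → a ≢ a′ → x ≢ y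
  levelsApart refl refl a≢a′ refl = a≢a′ refl

  fibre-avoids : ∀ {a m k} (F : Fibre≥ level a m) → level k ≢ a → ∀ i → element F i ≢ k
  fibre-avoids F k∉a i refl = k∉a (lies-over F i)

  levelSize≤4 : ∀ {a m} → Fibre≥ level a m → m ≤ 4
  levelSize≤4 {a} {m} F with m ≤? 4
  ... | yes m≤4 = m≤4
  ... | no m≰4 = ⊥-elim (atMostFourColours a (element F′) (injective F′) (occursAtLevel ∘ lies-over F′))
    where
    F′ = restrict (≰⇒> m≰4) F

  fullLevel : ∀ {a} → Fibre≥ level a 4 → ∀ p → level (colourAt a p) ≡ a
  fullLevel {a} F p with level (colourAt a p) ≟ a
  ... | yes same = same
  ... | no other = ⊥-elim (atMostFourColours a (colourAt a p ∷ element F)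
          (∷-injective (fibre-avoids F other) (injective F))
          λ { 0F → p , refl ; (suc i) → occursAtLevel (lies-over F i) })

  strayColoursAgree : ∀ {a p q} → Fibre≥ level a 3 → level (colourAt a p) ≢ a → level (colourAt a q) ≢ a →
                      colourAt a p ≡ colourAt a q
  strayColoursAgree {a} {p} {q} F p∉a q∉a with colourAt a p ≟ colourAt a q
  ... | yes same = same
  ... | no different = ⊥-elim (atMostFourColours a (colourAt a p ∷ colourAt a q ∷ element F)
          (∷-injective (λ { 0F → ≢-sym different ; (suc i) → fibre-avoids F p∉a i })
            (∷-injective (fibre-avoids F q∉a) (injective F)))
          λ { 0F → p , refl ; 1F → q , refl ; (suc (suc i)) → occursAtLevel (lies-over F i) })

  noTwoFullLevels : ∀ {A B C} → Distinct₃ A B C →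
                    Fibre≥ level A 4 → Fibre≥ level B 4 → Fibre≥ level C 1 → ⊥
  noTwoFullLevels (A≢B , A≢C , B≢C) FA FB FC = verticalNotInjective p
    (distinct⇒injective (levelsApart ℓA ℓB A≢B , levelsApart ℓA ℓC A≢C , levelsApart ℓB ℓC B≢C))
    where
    p = site (lies-over FC 0F)
    ℓA = fullLevel FA p
    ℓB = fullLevel FB p
    ℓC = levelAtSite (lies-over FC 0F)

  -- g is the colour in plane B above a point of the first level-C colour.
  strayColour : ∀ {A B C} → Distinct₃ A B C → Fibre≥ level A 4 → Fibre≥ level B 3 → Fibre≥ level C 3 →
                ∃ λ g → level g ≡ A × (∀ p → level (colourAt B p) ≡ B ⊎ colourAt B p ≡ g)
  strayColour {A} {B} {C} (A≢B , A≢C , B≢C) FA FB FC = β 0F , β₀-level , stray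
    where
    z : Fin 3 → Fin 10
    z = element FC
    p : Fin 3 → Cell
    p i = site (lies-over FC i)
    β : Fin 3 → Fin 10
    β i = colourAt B (p i)

    β-cases : ∀ i → level (β i) ≡ A ⊎ β i ≡ z i
    β-cases i = Sum.map (λ β≡α → trans (cong level β≡α) (fullLevel FA (p i)))
                        (λ β≡γ → trans β≡γ (colourAtSite (lies-over FC i)))
      (NotInjective.agrees-with-one _≟_ (verticalNotInjective (p i))
        (levelsApart (fullLevel FA (p i)) (levelAtSite (lies-over FC i)) A≢C) B)

    β-stray : ∀ i → level (β i) ≢ B
    β-stray i with β-cases i
    ... | inj₁ βA = λ βB → A≢B (trans (sym βA) βB)
    ... | inj₂ β≡z = λ βB → B≢C (trans (sym βB) (trans (cong level β≡z) (lies-over FC i)))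

    β₁≡β₀ : β 1F ≡ β 0F
    β₁≡β₀ = strayColoursAgree FB (β-stray 1F) (β-stray 0F)

    β₀-level : level (β 0F) ≡ A
    β₀-level with β-cases 0F | β-cases 1F
    ... | inj₁ βA | _ = βA
    ... | inj₂ β₀≡z₀ | inj₁ β₁A = ⊥-elim (levelsApart β₁A (lies-over FC 0F) A≢C (trans β₁≡β₀ β₀≡z₀))
    ... | inj₂ β₀≡z₀ | inj₂ β₁≡z₁ =
      contradiction (injective FC (trans (sym β₀≡z₀) (trans (sym β₁≡β₀) β₁≡z₁))) λ ()

    stray : ∀ q → level (colourAt B q) ≡ B ⊎ colourAt B q ≡ β 0F
    stray q with level (colourAt B q) ≟ B
    ... | yes same = inj₁ same
    ... | no other = inj₂ (strayColoursAgree FB other (β-stray 0F))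

  Background : Fin 10 → Set
  Background g = ∀ p → ∃ λ i₀ → ∀ i → i ≢ i₀ → colourAt i p ≡ g

  module OneFullLevel {A B C} (ABC : Distinct₃ A B C)
           (FA : Fibre≥ level A 4) (FB : Fibre≥ level B 3) (FC : Fibre≥ level C 3) where

    A≢B = proj₁ ABC
    A≢C = proj₁ (proj₂ ABC)
    B≢C = proj₂ (proj₂ ABC)

    strayB = strayColour ABC FA FB FC
    strayC = strayColour (A≢C , A≢B , ≢-sym B≢C) FA FC FB

    gB gC : Fin 10
    gB = proj₁ strayB
    gC = proj₁ strayC

    columnCases : ∀ p → (colourAt A p ≡ gB × colourAt B p ≡ gB) ⊎ (colourAt A p ≡ gC × colourAt C p ≡ gC) ⊎
                        (colourAt B p ≡ gB × colourAt C p ≡ gC × gB ≡ gC)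
    columnCases p with NotInjective.some-pair-agrees _≟_ (verticalNotInjective p) A B C
                     | proj₂ (proj₂ strayB) p | proj₂ (proj₂ strayC) p
    ... | inj₁ α≡β        | inj₂ β≡gB | _         = inj₁ (trans α≡β β≡gB , β≡gB)
    ... | inj₁ α≡β        | inj₁ βB   | _         = ⊥-elim (levelsApart (fullLevel FA p) βB A≢B α≡β)
    ... | inj₂ (inj₁ α≡γ) | _         | inj₂ γ≡gC = inj₂ (inj₁ (trans α≡γ γ≡gC , γ≡gC))
    ... | inj₂ (inj₁ α≡γ) | _         | inj₁ γC   = ⊥-elim (levelsApart (fullLevel FA p) γC A≢C α≡γ)
    ... | inj₂ (inj₂ β≡γ) | inj₂ β≡gB | inj₂ γ≡gC =
      inj₂ (inj₂ (β≡gB , γ≡gC , trans (sym β≡gB) (trans β≡γ γ≡gC)))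
    ... | inj₂ (inj₂ β≡γ) | inj₁ βB   | inj₁ γC   = ⊥-elim (levelsApart βB γC B≢C β≡γ)
    ... | inj₂ (inj₂ β≡γ) | inj₁ βB   | inj₂ γ≡gC =
      ⊥-elim (levelsApart βB (proj₁ (proj₂ strayC)) (≢-sym A≢B) (trans β≡γ γ≡gC))
    ... | inj₂ (inj₂ β≡γ) | inj₂ β≡gB | inj₁ γC   =
      ⊥-elim (levelsApart (proj₁ (proj₂ strayB)) γC A≢C (trans (sym β≡gB) β≡γ))

    background : ∃ Background
    background with gB ≟ gC
    ... | yes gB≡gC = gB , λ p →
      let P = λ i → colourAt i p ≡ gB in
      [ (λ { (α , β) → C , allBut {P = P} ABC α β })
      , [ (λ { (α , γ) → B , allBut {P = P} (A≢C , A≢B , ≢-sym B≢C)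
                                      (trans α (sym gB≡gC)) (trans γ (sym gB≡gC)) })
        , (λ { (β , γ , _) → A , allBut {P = P} (B≢C , ≢-sym A≢B , ≢-sym A≢C) β (trans γ (sym gB≡gC)) })
        ]′ ]′ (columnCases p)
    ... | no gB≢gC = ⊥-elim (noInjectionIntoPair (injective FA′) (λ i → inPair (lies-over FA′ i)))
      where
      FA′ = restrict (n≤1+n 3) FA
      inPair : ∀ {k} → level k ≡ A → k ≡ gB ⊎ k ≡ gC
      inPair e with columnCases (site e)
      ... | inj₁ (α≡gB , _) = inj₁ (trans (sym (colourAtSite e)) α≡gB)
      ... | inj₂ (inj₁ (α≡gC , _)) = inj₂ (trans (sym (colourAtSite e)) α≡gC)
      ... | inj₂ (inj₂ (_ , _ , gB≡gC)) = ⊥-elim (gB≢gC gB≡gC)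

  background : ∃ Background
  background with fibreSizes level
  ... | m , total , F with partition-of-10 (levelSize≤4 (F 0F)) (levelSize≤4 (F 1F)) (levelSize≤4 (F 2F)) total
  ... | inj₁ (p , q , r) =
    ⊥-elim (noTwoFullLevels ((λ ()) , (λ ()) , (λ ())) (restrict p (F 0F)) (restrict q (F 1F)) (restrict r (F 2F)))
  ... | inj₂ (inj₁ (p , q , r)) =
    ⊥-elim (noTwoFullLevels ((λ ()) , (λ ()) , (λ ())) (restrict p (F 0F)) (restrict q (F 2F)) (restrict r (F 1F)))
  ... | inj₂ (inj₂ (inj₁ (p , q , r))) =
    ⊥-elim (noTwoFullLevels ((λ ()) , (λ ()) , (λ ())) (restrict p (F 1F)) (restrict q (F 2F)) (restrict r (F 0F)))
  ... | inj₂ (inj₂ (inj₂ (inj₁ (p , q , r)))) =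
    OneFullLevel.background ((λ ()) , (λ ()) , (λ ())) (restrict p (F 0F)) (restrict q (F 1F)) (restrict r (F 2F))
  ... | inj₂ (inj₂ (inj₂ (inj₂ (inj₁ (p , q , r))))) =
    OneFullLevel.background ((λ ()) , (λ ()) , (λ ())) (restrict p (F 1F)) (restrict q (F 0F)) (restrict r (F 2F))
  ... | inj₂ (inj₂ (inj₂ (inj₂ (inj₂ (p , q , r))))) =
    OneFullLevel.background ((λ ()) , (λ ()) , (λ ())) (restrict p (F 2F)) (restrict q (F 0F)) (restrict r (F 1F))

  module Normalised {g} (bg : Background g) where

    oddLevel : Section
    oddLevel p = proj₁ (bg p)

    oddColour : Cell → Fin 10
    oddColour p = colourAt (oddLevel p) p

    relabel : Fin 10 → Fin 10
    relabel = g ∷ oddColour ∘ remQuot 3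

    normalForm : ∀ x → c x ≡ relabel (canonical oddLevel x)
    normalForm ⟨ a , b , d ⟩ with a ≟ oddLevel (b , d)
    ... | yes refl = cong oddColour (sym (remQuot-combine b d))
    ... | no a≢odd = proj₂ (bg (b , d)) a a≢odd

    relabel-surjective : StrictlySurjective _≡_ relabel
    relabel-surjective k = canonical oddLevel (proj₁ (usesAll k)) , trans (sym (normalForm _)) (proj₂ (usesAll k))

    relabel-injective : Injective _≡_ _≡_ relabel
    relabel-injective = surjective⇒injective relabel-surjective

    oddColour-relabelled : ∀ p → oddColour p ≡ relabel (suc (uncurry combine p))
    oddColour-relabelled (b , d) = cong oddColour (sym (remQuot-combine b d))

    oddColour-injective : Injective _≡_ _≡_ oddColour
    oddColour-injective {b , d} {b′ , d′} eq = begin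
      (b , d)                   ≡⟨ sym (remQuot-combine b d) ⟩
      remQuot 3 (combine b d)   ≡⟨ cong (remQuot 3) (suc-injective
                                     (relabel-injective {suc (combine b d)} {suc (combine b′ d′)}
                                       (trans (sym (oddColour-relabelled _)) (trans eq (oddColour-relabelled _))))) ⟩
      remQuot 3 (combine b′ d′) ≡⟨ remQuot-combine b′ d′ ⟩
      (b′ , d′)                 ∎
      where open ≡-Reasoning

    oddColour≢g : ∀ p → oddColour p ≢ g
    oddColour≢g p eq =
      contradiction (relabel-injective {suc (uncurry combine p)} {0F} (trans (sym (oddColour-relabelled p)) eq)) λ ()

    graphColour : ∀ {x} → OnGraph oddLevel x → c x ≡ oddColour (cellOf x)
    graphColour {⟨ a , b , d ⟩} refl = refl

    colourDichotomy : ∀ x → c x ≡ g ⊎ c x ≡ oddColour (cellOf x)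
    colourDichotomy ⟨ a , b , d ⟩ with a ≟ oddLevel (b , d)
    ... | yes refl = inj₂ refl
    ... | no a≢odd = inj₁ (proj₂ (bg (b , d)) a a≢odd)

    graphColourApart : ∀ {x y} → OnGraph oddLevel x → cellOf x ≢ cellOf y → c x ≢ c y
    graphColourApart {x} {y} on x≢y cx≡cy with colourDichotomy y
    ... | inj₁ cy≡g = oddColour≢g (cellOf x) (trans (sym (graphColour on)) (trans cx≡cy cy≡g))
    ... | inj₂ cy≡odd = x≢y (oddColour-injective (trans (sym (graphColour on)) (trans cx≡cy cy≡odd)))

    nonVertical-noTwoOnGraph : ∀ {w} → IsLine w →
                               (∀ {i j} → i ≢ j → cellOf (apply w i) ≢ cellOf (apply w j)) →
                               ∀ i j → i ≢ j → OnGraph oddLevel (apply w i) → ¬ OnGraph oddLevel (apply w j)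
    nonVertical-noTwoOnGraph line apart i j i≢j on-i on-j with another i j
    ... | k , k≢i , k≢j = lineNotInjective line (distinct⇒injective
          ( graphColourApart on-i (apart i≢j)
          , graphColourApart on-i (apart (≢-sym k≢i))
          , graphColourApart on-j (apart (≢-sym k≢j))))

    oddLevel-lineFree : LineFree oddLevel
    oddLevel-lineFree ⟨ _ , ⋆ , _ ⟩ line = nonVertical-noTwoOnGraph line λ i≢j → i≢j ∘ cong proj₁
    oddLevel-lineFree ⟨ _ , just _ , ⋆ ⟩ line = nonVertical-noTwoOnGraph line λ i≢j → i≢j ∘ cong proj₂
    oddLevel-lineFree ⟨ ⋆ , just _ , just _ ⟩ _ i j i≢j on-i on-j = i≢j (trans on-i (sym on-j))
    oddLevel-lineFree ⟨ just _ , just _ , just _ ⟩ (here ())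
    oddLevel-lineFree ⟨ just _ , just _ , just _ ⟩ (there (here ()))
    oddLevel-lineFree ⟨ just _ , just _ , just _ ⟩ (there (there (here ())))

    sameUpToRenaming : ∀ {f} → oddLevel ≐ f → SameUpToRenaming (canonical f) c
    sameUpToRenaming oddLevel≐f = permutation relabel relabel-surjective ,
      λ x → trans (normalForm x) (cong relabel (canonical-≐ oddLevel≐f x))

  classify : SameUpToRenaming (canonical F₁) c ⊎ SameUpToRenaming (canonical F₂) c
  classify = Sum.map sameUpToRenaming sameUpToRenaming (lineFree-classification oddLevel oddLevel-lineFree)
    where open Normalised (proj₂ background)

lemma4p5 : Σ (Coloring (Fin 10)) λ c₁ → Σ (Coloring (Fin 10)) λ c₂ →
    Good 10 c₁ × Good 10 c₂ × ¬ SameUpToRenaming c₁ c₂ ×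
    ((c : Coloring (Fin 10)) → Good 10 c → SameUpToRenaming c₁ c ⊎ SameUpToRenaming c₂ c)
lemma4p5 = canonical F₁ , canonical F₂ ,
           (canonical-rainbowFree (from-yes (lineFree? F₁)) , canonical-usesAll F₁) ,
           (canonical-rainbowFree (from-yes (lineFree? F₂)) , canonical-usesAll F₂) ,
           canonical-F₁≉F₂ ,
           λ c (rainbowFree , usesAll) → Classification.classify c rainbowFree usesAll
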